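{- In the setting below, let $\gamma$ be a proper generalizer. If $\mathrm{GCG}_{\simeq}(\Phi,\psi,\gamma)$ maintains Property 3 (for the generalizer $\gamma$) as an invariant, then it also maintains Property 2.
   Context: LTS setting. A labeled transition system (LTS) is $\langle\Sigma,Q,Q_0,\Delta\rangle$ (finite labels $\Sigma$, finite states $Q$, initial states $Q_0\subseteq Q$, $\Delta\subseteq Q\times\Sigma\times Q$). Fix an LTS $M_0=\langle\Sigma,Q,Q_0,\Delta_0\rangle$; a completion of $M_0$ is an LTS with the same $\Sigma,Q,Q_0$ and a transition relation $\Delta\supseteq\Delta_0$. Let $V=\{x_{p,a,q}: p,q\in Q, a\in\Sigma\}$ be Boolean variables; an assignment $\sigma:V\to\{0,1\}$ encodes the LTS $M_\sigma$ with $\Sigma,Q,Q_0$ and $\Delta_\sigma=\{(p,a,q):\sigma(x_{p,a,q})=1\}$. $\Phi$ is a propositional formula over $V$ that implies $\bigwedge_{(p,a,q)\in\Delta_0}x_{p,a,q}$ (so every satisfying assignment encodes a completion of $M_0$). Let $A$ be the set of non-initial states of $M_0$ with no incoming or outgoing transitions in $\Delta_0$. For assignments $\sigma,\rho$ satisfying $\Phi$, $\sigma\simeq\rho$ means there is a bijection $f:Q\to Q$ with $f(q)=q$ for $q\notin A$ such that $(p,a,q)\in\Delta_\sigma$ iff $(f(p),a,f(q))\in\Delta_\rho$. For $\rho\models\Phi$, $[\rho]=\{\sigma:\sigma\models\Phi,\ \sigma\simeq\rho\}$, also viewed as the formula satisfied exactly by its elements. $\psi$ is a specification with satisfaction relation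 $M\models\psi$, assumed invariant under isomorphism: if $\sigma\simeq\rho$ then $M_\sigma\models\psi$ iff $M_\rho\models\psi$. An assignment is identified with the formula satisfied by exactly it. A generalizer maps assignments to formulas over $V$; $\gamma$ is proper if for every $\sigma\models\Phi$ with $M_\sigma\not\models\psi$: $\sigma\models\gamma(\sigma)$, and no $\rho$ with $\rho\models\Phi$, $M_\rho\models\psi$ satisfies $\gamma(\sigma)$. Algorithm $\mathrm{GCG}_{\simeq}(\Phi,\psi,g)$ for a generalizer $g$: keep $\Phi_{cur}:=\Phi$; while $\Phi_{cur}$ is satisfiable, pick an arbitrary $\sigma\models\Phi_{cur}$ (a candidate); if $M_\sigma\models\psi$, output $\sigma$ (a solution) and set $\Phi_{cur}:=\Phi_{cur}\wedge\neg[\sigma]$; else set $\Phi_{cur}:=\Phi_{cur}\wedge\neg g(\sigma)$. In an execution, $\mathsf{Cand}$ and $\mathsf{Sol}$ are the sets of candidates and of solutions, and, at any point, $\mathsf{Pruned}$ is the set of all assignments satisfying some formula $\varphi$ for which a step $\Phi_{cur}:=\Phi_{cur}\wedge\neg\varphi$ has been performed so far. Properties (of the algorithm run with generalizer $g$): Property 2: for every terminated execution and every $\sigma\models\Phi$, $[\sigma]\cap\mathsf{Cand}$ has at most one element. Property 3 (invariant): in every execution, at every point, for every $\sigma$ for which the step $\Phi_{cur}:=\Phi_{cur}\wedge\neg g(\sigma)$ has been performed so far and every $\rho\simeq\sigma$, every assignment satisfying $g(\rho)$ belongs to $\mathsf{Pruned}$. -}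

module Defs where

open import Data.Nat using (ℕ)
open import Data.Fin using (Fin)
open import Data.Bool using (Bool; true; false)
open import Data.Product using (Σ; ∃; _×_; _,_)
open import Data.List using (List; []; _∷_)
open import Data.List.Relation.Unary.Any using (Any)
open import Data.List.Membership.Propositional using (_∈_)
open import Data.Fin.Permutation using (Permutation′; _⟨$⟩ʳ_)
open import Relation.Binary.PropositionalEquality using (_≡_)
open import Relation.Nullary using (¬_)
open import Function.Bundles using (_⇔_)

-- An LTS with label set Fin k and state set Fin n.
-- initial q ≡ true  iff  q ∈ Q₀ ;  trans p a q ≡ true  iff  (p,a,q) ∈ Δ.
record LTS (n k : ℕ) : Set where
  field
    initial : Fin n → Bool
    trans   : Fin n → Fin k → Fin n → Bool

-- An assignment σ : V → {0,1}, with σ p a q the value of x_{p,a,q}.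
Assignment : ℕ → ℕ → Set
Assignment n k = Fin n → Fin k → Fin n → Bool

-- A propositional formula over V, identified with its truth function
-- (V is finite, so every Boolean function on assignments is a formula).
Formula : ℕ → ℕ → Set
Formula n k = Assignment n k → Bool

_≐_ : ∀ {n k} → Assignment n k → Assignment n k → Set
σ ≐ ρ = ∀ p a q → σ p a q ≡ ρ p a q

module Setting {n k : ℕ} (M₀ : LTS n k) (Φ : Formula n k) where
  open LTS M₀

  PhiCompletes : Set
  PhiCompletes = ∀ σ → Φ σ ≡ true → ∀ p a q → trans p a q ≡ true → σ p a q ≡ true

  InA : Fin n → Set
  InA q = (initial q ≡ false)
        × (∀ a r → trans q a r ≡ false)
        × (∀ p a → trans p a q ≡ false)

  M : Assignment n k → LTS n k
  M σ = record { initial = initial ; trans = σ }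

  _≃_ : Assignment n k → Assignment n k → Set
  σ ≃ ρ = (Φ σ ≡ true) × (Φ ρ ≡ true)
        × Σ (Permutation′ n) (λ f →
            (∀ q → ¬ InA q → f ⟨$⟩ʳ q ≡ q)
          × (∀ p a q → (σ p a q ≡ true) ⇔ (ρ (f ⟨$⟩ʳ p) a (f ⟨$⟩ʳ q) ≡ true)))

  InClass : Assignment n k → Assignment n k → Set
  InClass ρ τ = (Φ τ ≡ true) × (τ ≃ ρ)

  -- ψ (given by its satisfaction relation Sat) is invariant under ≃
  SpecInvariant : (LTS n k → Set) → Set
  SpecInvariant Sat = ∀ σ ρ → σ ≃ ρ → (Sat (M σ) ⇔ Sat (M ρ))

  Proper : (LTS n k → Set) → (Assignment n k → Formula n k) → Set
  Proper Sat γ = ∀ σ → Φ σ ≡ true → ¬ Sat (M σ) →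
    (γ σ σ ≡ true) × (∀ ρ → Φ ρ ≡ true → Sat (M ρ) → γ σ ρ ≡ false)

  module GCG (Sat : LTS n k → Set) (g : Assignment n k → Formula n k) where

    -- One iteration of the loop: the candidate σ was either a solution
    -- (Φcur := Φcur ∧ ¬[σ]) or not (Φcur := Φcur ∧ ¬ g(σ)).
    data Event : Set where
      solution : Assignment n k → Event
      refuted  : Assignment n k → Event

    candidate : Event → Assignment n k
    candidate (solution σ) = σ
    candidate (refuted σ)  = σ

    prunedBy : Event → Assignment n k → Set
    prunedBy (solution σ) τ = InClass σ τ
    prunedBy (refuted σ)  τ = g σ τ ≡ true

    -- A history is the list of iterations performed so far, most recent first.
    Pruned : List Event → Assignment n k → Set
    Pruned h τ = Any (λ e → prunedBy e τ) h

    SatCur : List Event → Assignment n k → Set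
    SatCur h τ = (Φ τ ≡ true) × ¬ Pruned h τ

    data Run : List Event → Set where
      start   : Run []
      stepSol : ∀ {h} σ → Run h → SatCur h σ → Sat (M σ) → Run (solution σ ∷ h)
      stepRef : ∀ {h} σ → Run h → SatCur h σ → ¬ Sat (M σ) → Run (refuted σ ∷ h)

    Terminated : List Event → Set
    Terminated h = ¬ (∃ λ τ → SatCur h τ)

    Property2 : List Event → Set
    Property2 h = ∀ σ → Φ σ ≡ true → ∀ e₁ e₂ → e₁ ∈ h → e₂ ∈ h →
      InClass σ (candidate e₁) → InClass σ (candidate e₂) →
      candidate e₁ ≐ candidate e₂

    Property3 : List Event → Set
    Property3 h = ∀ σ → refuted σ ∈ h → ∀ ρ → ρ ≃ σ →
      ∀ τ → g ρ τ ≡ true → Pruned h τ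

{-# OPTIONS --safe #-}
module Submission where

-- Every candidate is drawn from Φcur, so it was not pruned earlier.  Anything
-- equivalent to an earlier candidate is, however, pruned: for a solution σ by
-- the step removing [σ], and for a refuted σ by Property 3, since properness
-- of γ gives τ ⊨ γ(τ) for every τ ≃ σ (τ fails ψ, as σ does).  So no two
-- distinct candidates are equivalent.

open import Defs
open import Data.Nat using (ℕ)
open import Data.Bool using (true)
open import Data.Product using (_,_; proj₁; proj₂)
open import Data.List using (List; _∷_)
open import Data.List.Relation.Unary.Any using (here; there)
open import Data.List.Membership.Propositional using (_∈_; lose)
open import Data.Fin.Permutation using (_⟨$⟩ʳ_; _⟨$⟩ˡ_; flip; _∘ₚ_; inverseˡ; inverseʳ)
open import Relation.Binary.PropositionalEquality using (_≡_; refl; sym; trans; cong; cong₂; subst)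
open import Relation.Nullary using (¬_; contradiction)
open import Function.Bundles using (_⇔_; Equivalence)
import Function.Properties.Equivalence as ⇔

module ≃-Properties {n k : ℕ} (M₀ : LTS n k) (Φ : Formula n k) where
  open Setting M₀ Φ

  ≃-sym : ∀ {σ ρ} → σ ≃ ρ → ρ ≃ σ
  ≃-sym {σ} {ρ} (Φσ , Φρ , f , f-fixes , f-iso) = Φρ , Φσ , flip f , f⁻¹-fixes , f⁻¹-iso
    where
    f⁻¹-fixes : ∀ q → ¬ InA q → f ⟨$⟩ˡ q ≡ q
    f⁻¹-fixes q q∉A = trans (cong (f ⟨$⟩ˡ_) (sym (f-fixes q q∉A))) (inverseˡ f)

    f⁻¹-iso : ∀ p a q → (ρ p a q ≡ true) ⇔ (σ (f ⟨$⟩ˡ p) a (f ⟨$⟩ˡ q) ≡ true)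
    f⁻¹-iso p a q = ⇔.sym (subst (λ b → (σ (f ⟨$⟩ˡ p) a (f ⟨$⟩ˡ q) ≡ true) ⇔ (b ≡ true))
                                 (cong₂ (λ p′ q′ → ρ p′ a q′) (inverseʳ f) (inverseʳ f))
                                 (f-iso (f ⟨$⟩ˡ p) a (f ⟨$⟩ˡ q)))

  ≃-trans : ∀ {σ ρ τ} → σ ≃ ρ → ρ ≃ τ → σ ≃ τ
  ≃-trans (Φσ , _ , f , f-fixes , f-iso) (_ , Φτ , g , g-fixes , g-iso) =
    Φσ , Φτ , f ∘ₚ g ,
    (λ q q∉A → trans (cong (g ⟨$⟩ʳ_) (f-fixes q q∉A)) (g-fixes q q∉A)) ,
    (λ p a q → ⇔.trans (f-iso p a q) (g-iso (f ⟨$⟩ʳ p) a (f ⟨$⟩ʳ q)))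

module _ {n k : ℕ} {M₀ : LTS n k} {Φ : Formula n k}
         {Sat : LTS n k → Set} {γ : Assignment n k → Formula n k} where
  open Setting M₀ Φ
  open GCG Sat γ
  open ≃-Properties M₀ Φ

  Run-tail : ∀ {e h} → Run (e ∷ h) → Run h
  Run-tail (stepSol _ r _ _) = r
  Run-tail (stepRef _ r _ _) = r

  candidate-satisfies-Φcur : ∀ {e h} → Run (e ∷ h) → SatCur h (candidate e)
  candidate-satisfies-Φcur (stepSol _ _ σ⊨Φcur _) = σ⊨Φcur
  candidate-satisfies-Φcur (stepRef _ _ σ⊨Φcur _) = σ⊨Φcur

  refuted-violates-spec : ∀ {h σ} → Run h → refuted σ ∈ h → ¬ Sat (M σ)
  refuted-violates-spec (stepRef _ _ _ σ⊭ψ) (here refl) = σ⊭ψ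
  refuted-violates-spec (stepSol _ r _ _)   (there σ∈h) = refuted-violates-spec r σ∈h
  refuted-violates-spec (stepRef _ r _ _)   (there σ∈h) = refuted-violates-spec r σ∈h

  module _ (invariant : SpecInvariant Sat) (proper : Proper Sat γ)
           (property3 : ∀ h → Run h → Property3 h) where

    ≃-candidate⇒Pruned : ∀ {h e τ} → Run h → e ∈ h → τ ≃ candidate e → Pruned h τ
    ≃-candidate⇒Pruned {e = solution σ} r e∈h τ≃σ = lose e∈h (proj₁ τ≃σ , τ≃σ)
    ≃-candidate⇒Pruned {h} {refuted σ} {τ} r e∈h τ≃σ =
      property3 h r σ e∈h τ τ≃σ τ (proj₁ (proper τ (proj₁ τ≃σ) τ⊭ψ))
      where
      τ⊭ψ : ¬ Sat (M τ)
      τ⊭ψ τ⊨ψ = refuted-violates-spec r e∈h (Equivalence.to (invariant τ σ τ≃σ) τ⊨ψ)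

    candidate-≄-earlier : ∀ {e e′ h} → Run (e ∷ h) → e′ ∈ h →
                          ¬ (candidate e ≃ candidate e′)
    candidate-≄-earlier r e′∈h c≃c′ =
      proj₂ (candidate-satisfies-Φcur r) (≃-candidate⇒Pruned (Run-tail r) e′∈h c≃c′)

    property2 : ∀ {h} → Run h → Property2 h
    property2 r σ _ e₁ e₂ (here refl) (here refl) _ _ = λ _ _ _ → refl
    property2 r σ _ e₁ e₂ (here refl) (there e₂∈h) (_ , c₁≃σ) (_ , c₂≃σ) =
      contradiction (≃-trans c₁≃σ (≃-sym c₂≃σ)) (candidate-≄-earlier r e₂∈h)
    property2 r σ _ e₁ e₂ (there e₁∈h) (here refl) (_ , c₁≃σ) (_ , c₂≃σ) =
      contradiction (≃-trans c₂≃σ (≃-sym c₁≃σ)) (candidate-≄-earlier r e₁∈h)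
    property2 r σ Φσ e₁ e₂ (there e₁∈h) (there e₂∈h) =
      property2 (Run-tail r) σ Φσ e₁ e₂ e₁∈h e₂∈h

theorem2 : ∀ {n k : ℕ} (M₀ : LTS n k) (Φ : Formula n k)
    (Sat : LTS n k → Set) (γ : Assignment n k → Formula n k) →
    Setting.PhiCompletes M₀ Φ →
    Setting.SpecInvariant M₀ Φ Sat →
    Setting.Proper M₀ Φ Sat γ →
    (∀ (h : List (Setting.GCG.Event M₀ Φ Sat γ)) →
      Setting.GCG.Run M₀ Φ Sat γ h → Setting.GCG.Property3 M₀ Φ Sat γ h) →
    ∀ (h : List (Setting.GCG.Event M₀ Φ Sat γ)) →
      Setting.GCG.Run M₀ Φ Sat γ h → Setting.GCG.Terminated M₀ Φ Sat γ h →
      Setting.GCG.Property2 M₀ Φ Sat γ h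
theorem2 M₀ Φ Sat γ _ invariant proper property3 h r _ =
  property2 invariant proper property3 r
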